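{- Let $\varepsilon>0$. There exists a set $A$ of integers $\ge 2$ such that: (i) $\sum_{a\in A}\frac{1}{a-1}<\varepsilon$, and (ii) for every integer $s\ge 1$, the sequence $\mathrm{Pow}(A;s)$ is complete.
   Context: For a (finite or infinite) set $A$ of integers greater than $1$ and an integer $s\ge1$, $\mathrm{Pow}(A;s)$ denotes the nondecreasing sequence of positive integers of the form $a^k$ with $a\in A$ and $k\ge s$. For a sequence $S=\{s_1,s_2,\dots\}$ of positive integers, let $\Sigma(S)=\{\sum_{i\ge1}\varepsilon_i s_i : \varepsilon_i\in\{0,1\},\ \sum_i\varepsilon_i<\infty\}$ be the set of finite sums of distinct terms of $S$. The sequence $S$ is called complete if $\Sigma(S)$ contains all sufficiently large integers. -}

module Defs where

open import Data.Bool using (Bool; true; false; if_then_else_)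
open import Data.Nat using (ℕ; zero; suc; _≤_; _^_)
open import Data.Integer using (+_)
open import Data.Rational using (ℚ; 0ℚ; _/_; _+_)
open import Data.List using (List; map)
open import Data.Nat.ListAction using (sum)
open import Data.List.Relation.Unary.All using (All)
open import Data.List.Relation.Unary.Unique.Propositional using (Unique)
open import Data.Product using (_×_; _,_; proj₁; proj₂; ∃-syntax)
open import Relation.Binary.PropositionalEquality using (_≡_)

Set⁺ : Set
Set⁺ = ℕ → Bool

AllGe2 : Set⁺ → Set
AllGe2 A = ∀ a → A a ≡ true → 2 ≤ a

-- term m = 1/(a-1) for a = m+2 if a ∈ A, else 0.
recipTerm : Set⁺ → ℕ → ℚ
recipTerm A m = if A (suc (suc m)) then (+ 1) / suc m else 0ℚ

-- partialRecipSum A N = Σ_{a ∈ A, 2 ≤ a ≤ N+1} 1/(a-1)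
partialRecipSum : Set⁺ → ℕ → ℚ
partialRecipSum A zero = 0ℚ
partialRecipSum A (suc N) = partialRecipSum A N + recipTerm A N

-- Terms are indexed by pairs, so equal values coming
-- from different pairs are distinct terms of the sequence (multiset).
IsPowIndex : Set⁺ → ℕ → ℕ × ℕ → Set
IsPowIndex A s (a , k) = (A a ≡ true) × (s ≤ k)

powValue : ℕ × ℕ → ℕ
powValue (a , k) = a ^ k

InSubsetSums : Set⁺ → ℕ → ℕ → Set
InSubsetSums A s n =
  ∃[ is ] (All (IsPowIndex A s) is × Unique is × sum (map powValue is) ≡ n)

PowComplete : Set⁺ → ℕ → Set
PowComplete A s = ∃[ N ] (∀ n → N ≤ n → InSubsetSums A s n)

module Submission where

-- A is the union of {2^2^c}, {2^2^c + 1} and {(c + 2)^2} over c ≥ Q. In each family the i-th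
-- element is at least (Q + i + 2)^2, so its reciprocal sum telescopes to at most 2/(Q + 1), and Q
-- is chosen with 6/(Q + 1) < ε.
--
-- For completeness of Pow(A; s), write (1 + x)^s - 1 with x = 2^2^d as a sum of powers x^e with
-- e ≥ 1; since x^e = (2^2^c)^(2^(d - c) e), each monomial can be given its own base 2^2^c. A block
-- built this way realises both (1 + x)^s - 1 and, through the single term (x + 1)^s, (1 + x)^s;
-- R blocks with disjoint bases therefore cover an interval of length R. The terms ((c + 2)^2)^(s+1),
-- whose consecutive ratios are at most 2 by Bernoulli's inequality, extend that interval to all
-- large integers by Brown's criterion.

open import Defs
open import Algebra.Bundles using (CommutativeMonoid)
open import Data.Bool using (true; false; _∨_)
open import Data.Bool.Properties using (∨-zeroʳ)
open import Data.Empty using (⊥-elim)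
open import Data.Integer as ℤ using (+≤+; +<+)
import Data.Integer.Properties as ℤ
open import Data.List using (List; []; _∷_; _++_; map; length)
import Data.List.Properties as List
open import Data.List.Relation.Unary.All as All using (All; []; _∷_)
import Data.List.Relation.Unary.All.Properties as All
open import Data.List.Relation.Unary.Unique.Propositional using (Unique; []; _∷_)
import Data.List.Relation.Unary.Unique.Propositional.Properties as Unique
open import Data.Nat as ℕ using (ℕ; zero; suc; _+_; _*_; _^_; _∸_; _≤_; _<_; z≤n; s≤s; _≟_)
open import Data.Nat.ListAction using (sum)
open import Data.Nat.ListAction.Properties using (sum-++)
import Data.Nat.Properties as ℕ
open import Data.Nat.Tactic.RingSolver using (solve-∀)
open import Data.Product using (_×_; _,_; proj₁; proj₂; ∃-syntax)
open import Data.Rational as ℚ using (ℚ; 0ℚ; mkℚ) renaming (_<_ to _<ℚ_; _≤_ to _≤ℚ_)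
import Data.Rational.Properties as ℚ
open import Data.Rational.Unnormalised as ℚᵘ using (mkℚᵘ; *≤*; *<*)
import Data.Rational.Unnormalised.Properties as ℚᵘ
open import Data.Sum using (_⊎_; inj₁; inj₂)
open import Function using (_∘_)
open import Level using (0ℓ)
open import Relation.Binary.Definitions using (Monotonic₁; tri<; tri≈; tri>)
open import Relation.Binary.PropositionalEquality
open import Relation.Nullary using (yes; no; does)
open import Relation.Nullary.Decidable using (dec-true)
open import Relation.Unary using (Pred; ∅; _∪_; _∩_; _⊆_; _⊥_)

open import Algebra.Properties.CommutativeSemigroup
  (CommutativeMonoid.commutativeSemigroup ℚ.+-0-commutativeMonoid) using () renaming (interchange to ℚ-+-interchange)

-- Rationals a / (1 + b), the form in which recipTerm writes 1/(a - 1)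

infixl 7 _/1+_
_/1+_ : ℕ → ℕ → ℚ
a /1+ b = ℤ.+ a ℚ./ suc b

private
  toℚᵘ-/1+ : ∀ a b → ℚ.toℚᵘ (a /1+ b) ℚᵘ.≃ mkℚᵘ (ℤ.+ a) b
  toℚᵘ-/1+ a b = ℚ.toℚᵘ-fromℚᵘ (mkℚᵘ (ℤ.+ a) b)

/1+-cross-≤ : ∀ a b c d → a * suc d ≤ c * suc b → a /1+ b ≤ℚ c /1+ d
/1+-cross-≤ a b c d le = ℚ.toℚᵘ-cancel-≤
  (ℚᵘ.≤-respˡ-≃ (ℚᵘ.≃-sym (toℚᵘ-/1+ a b)) (ℚᵘ.≤-respʳ-≃ (ℚᵘ.≃-sym (toℚᵘ-/1+ c d))
    (*≤* (subst₂ ℤ._≤_ (ℤ.pos-* a (suc d)) (ℤ.pos-* c (suc b)) (+≤+ le)))))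

/1+-cross-< : ∀ a b c d → a * suc d < c * suc b → a /1+ b <ℚ c /1+ d
/1+-cross-< a b c d lt = ℚ.toℚᵘ-cancel-<
  (ℚᵘ.<-respˡ-≃ (ℚᵘ.≃-sym (toℚᵘ-/1+ a b)) (ℚᵘ.<-respʳ-≃ (ℚᵘ.≃-sym (toℚᵘ-/1+ c d))
    (*<* (subst₂ ℤ._<_ (ℤ.pos-* a (suc d)) (ℤ.pos-* c (suc b)) (+<+ lt)))))

/1+-+-cross-≤ : ∀ a b c d e f → (a * suc d + c * suc b) * suc f ≤ e * (suc b * suc d) →
                a /1+ b ℚ.+ c /1+ d ≤ℚ e /1+ f
/1+-+-cross-≤ a b c d e f le = ℚ.toℚᵘ-cancel-≤
  (ℚᵘ.≤-respˡ-≃ (ℚᵘ.≃-sym (ℚᵘ.≃-trans (ℚ.toℚᵘ-homo-+ (a /1+ b) (c /1+ d))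
                                       (ℚᵘ.+-cong (toℚᵘ-/1+ a b) (toℚᵘ-/1+ c d))))
  (ℚᵘ.≤-respʳ-≃ (ℚᵘ.≃-sym (toℚᵘ-/1+ e f))
    (*≤* (subst₂ ℤ._≤_ numerator (ℤ.pos-* e (suc b * suc d)) (+≤+ le)))))
  where
  numerator : ℤ.+ ((a * suc d + c * suc b) * suc f) ≡ ((ℤ.+ a ℤ.* ℤ.+ suc d) ℤ.+ (ℤ.+ c ℤ.* ℤ.+ suc b)) ℤ.* ℤ.+ suc f
  numerator = trans (ℤ.pos-* (a * suc d + c * suc b) (suc f))
    (cong (ℤ._* ℤ.+ suc f) (trans (ℤ.pos-+ (a * suc d) (c * suc b))
                                  (cong₂ ℤ._+_ (ℤ.pos-* a (suc d)) (ℤ.pos-* c (suc b)))))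

0≤/1+ : ∀ a b → 0ℚ ≤ℚ a /1+ b
0≤/1+ a b = subst (_≤ℚ a /1+ b) (ℚ.0/n≡0 1) (/1+-cross-≤ 0 0 a b z≤n)

/1+-+-≤ : ∀ a c b → a /1+ b ℚ.+ c /1+ b ≤ℚ (a + c) /1+ b
/1+-+-≤ a c b = /1+-+-cross-≤ a b c b (a + c) b (ℕ.≤-reflexive (identity a c (suc b)))
  where
  identity : ∀ a c q → (a * q + c * q) * q ≡ (a + c) * (q * q)
  identity = solve-∀

k/1+[k*↧ₙε]<ε : ∀ k ε → 0ℚ <ℚ ε → k /1+ (k * ℚ.↧ₙ ε) <ℚ ε
k/1+[k*↧ₙε]<ε k (mkℚ (ℤ.+ zero) _ _)    (ℚ.*<* 0<0) = ⊥-elim (ℤ.<-irrefl refl 0<0)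
k/1+[k*↧ₙε]<ε k (mkℚ ℤ.-[1+ _ ] _ _)    (ℚ.*<* ())
k/1+[k*↧ₙε]<ε k ε@(mkℚ (ℤ.+ suc p) d _) _ = subst (k /1+ (k * suc d) <ℚ_) (ℚ.↥p/↧p≡p ε)
  (/1+-cross-< k (k * suc d) (suc p) d (ℕ.<-≤-trans (ℕ.n<1+n _) (ℕ.m≤n*m _ (suc p))))

-- Squares, towers and Bernoulli's inequality

sq : ℕ → ℕ
sq n = n * n

sq-mono-< : Monotonic₁ _<_ _<_ sq
sq-mono-< m<n = ℕ.*-mono-< m<n m<n

2≤sq[2+n] : ∀ n → 2 ≤ sq (2 + n)
2≤sq[2+n] n = ℕ.≤-trans (ℕ.m≤m+n 2 n) (ℕ.m≤m*n (2 + n) (2 + n))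

n≤sq[2+n] : ∀ n → n ≤ sq (2 + n)
n≤sq[2+n] n = ℕ.≤-trans (ℕ.m≤n+m n 2) (ℕ.m≤m*n (2 + n) (2 + n))

sq^≡^ : ∀ a n → sq a ^ n ≡ a ^ (n + n)
sq^≡^ a zero    = refl
sq^≡^ a (suc n) = begin
  a * a * sq a ^ n      ≡⟨ cong (a * a *_) (sq^≡^ a n) ⟩
  a * a * a ^ (n + n)   ≡⟨ ℕ.*-assoc a a (a ^ (n + n)) ⟩
  a * a ^ suc (n + n)   ≡⟨ cong (λ x → a * a ^ x) (ℕ.+-suc n n) ⟨
  a ^ (suc n + suc n)   ∎
  where open ≡-Reasoning

2*n≤2^n : ∀ n → 2 * n ≤ 2 ^ n
2*n≤2^n zero          = z≤n
2*n≤2^n (suc zero)    = ℕ.≤-refl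
2*n≤2^n (suc (suc n)) = subst₂ _≤_ (sym (lhs n)) (sym (rhs (2 ^ suc n)))
  (ℕ.+-mono-≤ (2*n≤2^n (suc n)) (ℕ.^-monoʳ-≤ 2 (s≤s (z≤n {n}))))
  where
  lhs : ∀ n → 2 * (2 + n) ≡ 2 * (1 + n) + 2
  lhs = solve-∀
  rhs : ∀ p → 2 * p ≡ p + p
  rhs = solve-∀

tower : ℕ → ℕ
tower c = 2 ^ 2 ^ c

tower-mono-< : Monotonic₁ _<_ _<_ tower
tower-mono-< = ℕ.^-monoʳ-< 2 (s≤s (s≤s z≤n)) ∘ ℕ.^-monoʳ-< 2 (s≤s (s≤s z≤n))

2≤tower : ∀ c → 2 ≤ tower c
2≤tower c = ℕ.^-monoʳ-≤ 2 (ℕ.m^n>0 2 c)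

n≤tower : ∀ n → n ≤ tower n
n≤tower n = ℕ.≤-trans (ℕ.m≤n*m n 2) (ℕ.≤-trans (2*n≤2^n n)
              (ℕ.≤-trans (ℕ.m≤n*m (2 ^ n) 2) (2*n≤2^n (2 ^ n))))

sq[2+n]≤tower : ∀ {n} → 2 ≤ n → sq (2 + n) ≤ tower n
sq[2+n]≤tower {n} 2≤n = begin
  (2 + n) * (2 + n)   ≤⟨ ℕ.*-mono-≤ 2+n≤2^n 2+n≤2^n ⟩
  2 ^ n * 2 ^ n       ≡⟨ ℕ.^-distribˡ-+-* 2 n n ⟨
  2 ^ (n + n)         ≤⟨ ℕ.^-monoʳ-≤ 2 n+n≤2^n ⟩
  tower n             ∎
  where
  open ℕ.≤-Reasoning
  n+n≤2^n : n + n ≤ 2 ^ n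
  n+n≤2^n = subst (_≤ 2 ^ n) (cong (n +_) (ℕ.+-identityʳ n)) (2*n≤2^n n)
  2+n≤2^n : 2 + n ≤ 2 ^ n
  2+n≤2^n = ℕ.≤-trans (ℕ.+-monoˡ-≤ n 2≤n) n+n≤2^n

bernoulli : ∀ y m → (1 + y) ^ m * (1 + y) ≤ (1 + y) * y ^ m + m * (1 + y) ^ m
bernoulli y zero    = ℕ.≤-reflexive (trans (ℕ.*-comm 1 (1 + y)) (sym (ℕ.+-identityʳ _)))
bernoulli y (suc m) = begin
  (1 + y) * P * (1 + y)                   ≡⟨ ℕ.*-assoc (1 + y) P (1 + y) ⟩
  (1 + y) * (P * (1 + y))                 ≤⟨ ℕ.*-monoʳ-≤ (1 + y) (bernoulli y m) ⟩
  (1 + y) * ((1 + y) * Y + m * P)         ≡⟨ split y Y P m ⟩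
  (1 + y) * y * Y + (1 + y) * Y + m * ((1 + y) * P)
    ≤⟨ ℕ.+-monoˡ-≤ (m * ((1 + y) * P)) (ℕ.+-monoʳ-≤ ((1 + y) * y * Y)
         (ℕ.*-monoʳ-≤ (1 + y) (ℕ.^-monoˡ-≤ m (ℕ.n≤1+n y)))) ⟩
  (1 + y) * y * Y + (1 + y) * P + m * ((1 + y) * P)
    ≡⟨ merge y Y P m ⟩
  (1 + y) * (y * Y) + suc m * ((1 + y) * P) ∎
  where
  open ℕ.≤-Reasoning
  P = (1 + y) ^ m
  Y = y ^ m
  split : ∀ y Y P m → (1 + y) * ((1 + y) * Y + m * P) ≡ (1 + y) * y * Y + (1 + y) * Y + m * ((1 + y) * P)
  split = solve-∀
  merge : ∀ y Y P m → (1 + y) * y * Y + (1 + y) * P + m * ((1 + y) * P) ≡ (1 + y) * (y * Y) + (1 + m) * ((1 + y) * P)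
  merge = solve-∀

[1+y]^m≤2*y^m : ∀ y m → 2 * m ≤ 1 + y → (1 + y) ^ m ≤ 2 * y ^ m
[1+y]^m≤2*y^m y m 2m≤1+y =
  ℕ.*-cancelʳ-≤ P (2 * Y) (1 + y) (ℕ.+-cancelʳ-≤ (P * (1 + y)) (P * (1 + y)) (2 * Y * (1 + y)) (begin
    P * (1 + y) + P * (1 + y)       ≡⟨ double (P * (1 + y)) ⟩
    2 * (P * (1 + y))               ≤⟨ ℕ.*-monoʳ-≤ 2 (bernoulli y m) ⟩
    2 * ((1 + y) * Y + m * P)       ≡⟨ expand y Y P m ⟩
    2 * Y * (1 + y) + (2 * m) * P   ≤⟨ ℕ.+-monoʳ-≤ (2 * Y * (1 + y)) (ℕ.*-monoˡ-≤ P 2m≤1+y) ⟩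
    2 * Y * (1 + y) + (1 + y) * P   ≡⟨ cong (2 * Y * (1 + y) +_) (ℕ.*-comm (1 + y) P) ⟩
    2 * Y * (1 + y) + P * (1 + y)   ∎))
  where
  open ℕ.≤-Reasoning
  P = (1 + y) ^ m
  Y = y ^ m
  double : ∀ p → p + p ≡ 2 * p
  double = solve-∀
  expand : ∀ y Y P m → 2 * ((1 + y) * Y + m * P) ≡ 2 * Y * (1 + y) + (2 * m) * P
  expand = solve-∀

-- Reciprocal sums

infixr 6 _∪ᵇ_
_∪ᵇ_ : Set⁺ → Set⁺ → Set⁺
(F ∪ᵇ G) a = F a ∨ G a

∪ᵇ-introˡ : ∀ F G {a} → F a ≡ true → (F ∪ᵇ G) a ≡ true
∪ᵇ-introˡ F G {a} Fa = cong (_∨ G a) Fa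

∪ᵇ-introʳ : ∀ F G {a} → G a ≡ true → (F ∪ᵇ G) a ≡ true
∪ᵇ-introʳ F G {a} Ga = trans (cong (F a ∨_) Ga) (∨-zeroʳ (F a))

∪ᵇ-elim : ∀ F G {a} → (F ∪ᵇ G) a ≡ true → F a ≡ true ⊎ G a ≡ true
∪ᵇ-elim F G {a} e with F a
... | true  = inj₁ refl
... | false = inj₂ e

AllGe2-∪ᵇ : ∀ F G → AllGe2 F → AllGe2 G → AllGe2 (F ∪ᵇ G)
AllGe2-∪ᵇ F G F≥2 G≥2 a a∈F∪G with ∪ᵇ-elim F G a∈F∪G
... | inj₁ a∈F = F≥2 a a∈F
... | inj₂ a∈G = G≥2 a a∈G

-- The search for a preimage of a stops at a, so a value g i is found only when i ≤ g i.
image : (ℕ → ℕ) → Set⁺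
image g a = does (ℕ.anyUpTo? (λ i → g i ≟ a) (suc a))

image-sound : ∀ g a → image g a ≡ true → ∃[ i ] g i ≡ a
image-sound g a e with ℕ.anyUpTo? (λ i → g i ≟ a) (suc a)
... | yes (i , _ , gi≡a) = i , gi≡a

image-complete : ∀ g {a} i → i ≤ a → g i ≡ a → image g a ≡ true
image-complete g {a} i i≤a gi≡a = dec-true (ℕ.anyUpTo? (λ i → g i ≟ a) (suc a)) (i , s≤s i≤a , gi≡a)

image-shift-complete : ∀ g {Q c} → Q ≤ c → c ≤ g c → image (λ i → g (Q + i)) (g c) ≡ true
image-shift-complete g {Q} {c} Q≤c c≤gc =
  image-complete (λ i → g (Q + i)) (c ∸ Q) (ℕ.≤-trans (ℕ.m∸n≤m c Q) c≤gc) (cong g (ℕ.m+[n∸m]≡n Q≤c))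

AllGe2-image : ∀ g → (∀ i → 2 ≤ g i) → AllGe2 (image g)
AllGe2-image g 2≤g a a∈g with image-sound g a a∈g
... | i , refl = 2≤g i

private
  p≤p+q : ∀ p {q} → 0ℚ ≤ℚ q → p ≤ℚ p ℚ.+ q
  p≤p+q p 0≤q = subst (_≤ℚ p ℚ.+ _) (ℚ.+-identityʳ p) (ℚ.+-monoʳ-≤ p 0≤q)

recipTerm≤ : ∀ F m → recipTerm F m ≤ℚ 1 /1+ m
recipTerm≤ F m with F (suc (suc m))
... | true  = ℚ.≤-refl
... | false = 0≤/1+ 1 m

recipTerm-∪ᵇ : ∀ F G m → recipTerm (F ∪ᵇ G) m ≤ℚ recipTerm F m ℚ.+ recipTerm G m
recipTerm-∪ᵇ F G m with F (suc (suc m)) | G (suc (suc m))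
... | true  | true  = p≤p+q (1 /1+ m) (0≤/1+ 1 m)
... | true  | false = p≤p+q (1 /1+ m) ℚ.≤-refl
... | false | true  = ℚ.≤-reflexive (sym (ℚ.+-identityˡ (1 /1+ m)))
... | false | false = ℚ.≤-refl

partialRecipSum-∪ᵇ : ∀ F G N →
  partialRecipSum (F ∪ᵇ G) N ≤ℚ partialRecipSum F N ℚ.+ partialRecipSum G N
partialRecipSum-∪ᵇ F G zero    = ℚ.≤-refl
partialRecipSum-∪ᵇ F G (suc N) = ℚ.≤-trans
  (ℚ.+-mono-≤ (partialRecipSum-∪ᵇ F G N) (recipTerm-∪ᵇ F G N))
  (ℚ.≤-reflexive (ℚ-+-interchange (partialRecipSum F N) (partialRecipSum G N) (recipTerm F N) (recipTerm G N)))

private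
  value-outside-range : ∀ {g : ℕ → ℕ} {j n} → Monotonic₁ _<_ _<_ g →
    (∀ i → i < j → g i < n) → n < g j → ∀ i → g i ≢ n
  value-outside-range {g} {j} mono below above i gi≡n with ℕ.<-cmp i j
  ... | tri< i<j _ _  = ℕ.<-irrefl gi≡n (below i i<j)
  ... | tri≈ _ refl _ = ℕ.<-irrefl (sym gi≡n) above
  ... | tri> _ _ j<i  = ℕ.<-asym above (subst (g j <_) gi≡n (mono j<i))

-- Invariant: j elements of F lie below N + 2, and the reciprocal sum so far is at most φ 0 - φ j.
partialRecipSum-telescope : ∀ {F g} (φ : ℕ → ℚ) → Monotonic₁ _<_ _<_ g → 2 ≤ g 0 →
  (∀ a → F a ≡ true → ∃[ i ] g i ≡ a) →
  (∀ i → 1 /1+ (g i ∸ 2) ℚ.+ φ (suc i) ≤ℚ φ i) → (∀ i → 0ℚ ≤ℚ φ i) →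
  ∀ N → partialRecipSum F N ≤ℚ φ 0
partialRecipSum-telescope {F} {g} φ mono 2≤g₀ F⊆g step φ≥0 N =
  let j , _ , _ , bound = invariant N in ℚ.≤-trans (p≤p+q (partialRecipSum F N) (φ≥0 j)) bound
  where
  invariant : ∀ N → ∃[ j ] ((∀ i → i < j → g i < 2 + N) × 2 + N ≤ g j
                            × partialRecipSum F N ℚ.+ φ j ≤ℚ φ 0)
  invariant zero = 0 , (λ _ ()) , 2≤g₀ , ℚ.≤-reflexive (ℚ.+-identityˡ (φ 0))
  invariant (suc N) with invariant N
  ... | j , below , above , bound with g j ≟ 2 + N
  ...   | yes gj≡2+N = suc j , below′ , subst (_< g (suc j)) gj≡2+N (mono (ℕ.n<1+n j)) , bound′
    where
    below′ : ∀ i → i < suc j → g i < 3 + N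
    below′ i (s≤s i≤j) with ℕ.m≤n⇒m<n∨m≡n i≤j
    ... | inj₁ i<j  = ℕ.m<n⇒m<1+n (below i i<j)
    ... | inj₂ refl = s≤s (ℕ.≤-reflexive gj≡2+N)
    S = partialRecipSum F N
    step′ : 1 /1+ N ℚ.+ φ (suc j) ≤ℚ φ j
    step′ = subst (λ m → 1 /1+ m ℚ.+ φ (suc j) ≤ℚ φ j) (cong (_∸ 2) gj≡2+N) (step j)
    bound′ : S ℚ.+ recipTerm F N ℚ.+ φ (suc j) ≤ℚ φ 0
    bound′ = begin
      S ℚ.+ recipTerm F N ℚ.+ φ (suc j)  ≤⟨ ℚ.+-monoˡ-≤ (φ (suc j)) (ℚ.+-monoʳ-≤ S (recipTerm≤ F N)) ⟩
      S ℚ.+ 1 /1+ N ℚ.+ φ (suc j)        ≡⟨ ℚ.+-assoc S (1 /1+ N) (φ (suc j)) ⟩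
      S ℚ.+ (1 /1+ N ℚ.+ φ (suc j))      ≤⟨ ℚ.+-monoʳ-≤ S step′ ⟩
      S ℚ.+ φ j                          ≤⟨ bound ⟩
      φ 0                                ∎
      where open ℚ.≤-Reasoning
  ...   | no gj≢2+N = j , (λ i i<j → ℕ.m<n⇒m<1+n (below i i<j)) , 2+N<gj , bound′
    where
    2+N<gj : 2 + N < g j
    2+N<gj = ℕ.≤∧≢⇒< above (gj≢2+N ∘ sym)
    2+N∉F : F (2 + N) ≡ false
    2+N∉F with F (2 + N) in e
    ... | false = refl
    ... | true with F⊆g (2 + N) e
    ...   | i , gi≡2+N = ⊥-elim (value-outside-range mono below 2+N<gj i gi≡2+N)
    bound′ : partialRecipSum F N ℚ.+ recipTerm F N ℚ.+ φ j ≤ℚ φ 0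
    bound′ rewrite 2+N∉F | ℚ.+-identityʳ (partialRecipSum F N) = bound

/1+-telescope-step : ∀ z b → sq (2 + z) ≤ 2 + b → 1 /1+ b ℚ.+ 2 /1+ suc z ≤ℚ 2 /1+ z
/1+-telescope-step z b sq≤2+b = /1+-+-cross-≤ 1 b 2 (suc z) 2 z
  (subst₂ _≤_ (sym (lhs z b)) (sym (rhs z b)) (ℕ.+-monoˡ-≤ (2 * suc b * suc z) [2+z][1+z]≤2[1+b]))
  where
  lhs : ∀ z b → (1 * (2 + z) + 2 * (1 + b)) * (1 + z) ≡ (2 + z) * (1 + z) + 2 * (1 + b) * (1 + z)
  lhs = solve-∀
  rhs : ∀ z b → 2 * ((1 + b) * (2 + z)) ≡ 2 * (1 + b) + 2 * (1 + b) * (1 + z)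
  rhs = solve-∀
  double : ∀ b → 2 + b + b ≡ 2 * (1 + b)
  double = solve-∀
  [2+z][1+z]≤2[1+b] : (2 + z) * (1 + z) ≤ 2 * (1 + b)
  [2+z][1+z]≤2[1+b] = ℕ.≤-trans (ℕ.*-monoʳ-≤ (2 + z) (ℕ.n≤1+n (suc z)))
    (ℕ.≤-trans sq≤2+b (ℕ.≤-trans (ℕ.m≤m+n (2 + b) b) (ℕ.≤-reflexive (double b))))

partialRecipSum-sparse : ∀ {F g} Q → Monotonic₁ _<_ _<_ g → (∀ i → sq (2 + (Q + i)) ≤ g i) →
  (∀ a → F a ≡ true → ∃[ i ] g i ≡ a) → ∀ N → partialRecipSum F N ≤ℚ 2 /1+ Q
partialRecipSum-sparse {F} {g} Q mono sparse F⊆g N =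
  subst (partialRecipSum F N ≤ℚ_) (cong (2 /1+_) (ℕ.+-identityʳ Q))
    (partialRecipSum-telescope (λ i → 2 /1+ (Q + i)) mono (2≤g 0) F⊆g step (λ i → 0≤/1+ 2 (Q + i)) N)
  where
  2≤g : ∀ i → 2 ≤ g i
  2≤g i = ℕ.≤-trans (2≤sq[2+n] (Q + i)) (sparse i)
  step : ∀ i → 1 /1+ (g i ∸ 2) ℚ.+ 2 /1+ (Q + suc i) ≤ℚ 2 /1+ (Q + i)
  step i rewrite ℕ.+-suc Q i = /1+-telescope-step (Q + i) (g i ∸ 2)
    (subst (sq (2 + (Q + i)) ≤_) (sym (ℕ.m+[n∸m]≡n (2≤g i))) (sparse i))

-- Sums of distinct terms

SumOfDistinct : Pred (ℕ × ℕ) 0ℓ → ℕ → Set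
SumOfDistinct I n = ∃[ is ] (All I is × Unique is × sum (map powValue is) ≡ n)

SumOfDistinct-[] : ∀ {I} → SumOfDistinct I 0
SumOfDistinct-[] = [] , [] , [] , refl

SumOfDistinct-singleton : ∀ {I p} → I p → SumOfDistinct I (powValue p)
SumOfDistinct-singleton {p = p} Ip = p ∷ [] , Ip ∷ [] , [] ∷ [] , ℕ.+-identityʳ (powValue p)

SumOfDistinct-mono : ∀ {I J n} → I ⊆ J → SumOfDistinct I n → SumOfDistinct J n
SumOfDistinct-mono I⊆J (is , Iis , uniq , Σis) = is , All.map I⊆J Iis , uniq , Σis

SumOfDistinct-++ : ∀ {I J m n} → I ⊥ J → SumOfDistinct I m → SumOfDistinct J n → SumOfDistinct (I ∪ J) (m + n)
SumOfDistinct-++ I⊥J (is , Iis , uniq , Σis) (js , Jjs , uniq′ , Σjs) =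
  is ++ js ,
  All.++⁺ (All.map inj₁ Iis) (All.map inj₂ Jjs) ,
  Unique.++⁺ uniq uniq′ (λ (v∈is , v∈js) → I⊥J (All.lookup Iis v∈is , All.lookup Jjs v∈js)) ,
  trans (cong sum (List.map-++ powValue is js)) (trans (sum-++ (map powValue is) (map powValue js)) (cong₂ _+_ Σis Σjs))

Covers : Pred (ℕ × ℕ) 0ℓ → ℕ → ℕ → Set
Covers I N M = ∀ r → r ≤ M → SumOfDistinct I (N + r)

Covers-mono : ∀ {I J N M} → I ⊆ J → Covers I N M → Covers J N M
Covers-mono I⊆J cov r r≤M = SumOfDistinct-mono I⊆J (cov r r≤M)

-- Brown's criterion, one step.
Covers-extend : ∀ {I J N M u t} → I ⊥ J → Covers I N M →
  SumOfDistinct J u → SumOfDistinct J (u + t) → t ≤ suc M → Covers (I ∪ J) (N + u) (M + t)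
Covers-extend {I} {J} {N} {M} {u} {t} I⊥J cov Ju Ju+t t≤1+M r r≤M+t with r ℕ.≤? M
... | yes r≤M = subst (SumOfDistinct (I ∪ J)) (reorder N r u) (SumOfDistinct-++ I⊥J (cov r r≤M) Ju)
  where
  reorder : ∀ N r u → N + r + u ≡ N + u + r
  reorder = solve-∀
... | no r≰M = subst (SumOfDistinct (I ∪ J)) shift (SumOfDistinct-++ I⊥J (cov (r ∸ t) r∸t≤M) Ju+t)
  where
  t≤r : t ≤ r
  t≤r = ℕ.≤-trans t≤1+M (ℕ.≰⇒> r≰M)
  r∸t≤M : r ∸ t ≤ M
  r∸t≤M = subst (r ∸ t ≤_) (ℕ.m+n∸n≡m M t) (ℕ.∸-monoˡ-≤ t r≤M+t)
  reorder : ∀ N x u t → N + x + (u + t) ≡ N + u + (x + t)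
  reorder = solve-∀
  shift : N + (r ∸ t) + (u + t) ≡ N + u + r
  shift = trans (reorder N (r ∸ t) u t) (cong (N + u +_) (ℕ.m∸n+n≡m t≤r))

sumBelow : (ℕ → ℕ) → ℕ → ℕ
sumBelow u zero    = 0
sumBelow u (suc n) = sumBelow u n + u n

sumBelow-zero : ∀ n → sumBelow (λ _ → 0) n ≡ 0
sumBelow-zero zero    = refl
sumBelow-zero (suc n) = trans (ℕ.+-identityʳ _) (sumBelow-zero n)

n≤sumBelow : ∀ {u} → (∀ i → 1 ≤ u i) → ∀ n → n ≤ sumBelow u n
n≤sumBelow     u≥1 zero    = z≤n
n≤sumBelow {u} u≥1 (suc n) =
  subst (_≤ sumBelow u n + u n) (ℕ.+-comm n 1) (ℕ.+-mono-≤ (n≤sumBelow u≥1 n) (u≥1 n))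

Before : (ℕ → Pred (ℕ × ℕ) 0ℓ) → ℕ → Pred (ℕ × ℕ) 0ℓ
Before P n p = ∃[ i ] (i < n × P i p)

Covers-chain : ∀ {I P N M} (u t : ℕ → ℕ) → (∀ {i j} → j < i → P i ⊥ P j) → (∀ i → I ⊥ P i) →
  Covers I N M → (∀ i → SumOfDistinct (P i) (u i)) → (∀ i → SumOfDistinct (P i) (u i + t i)) →
  (∀ i → t i ≤ suc (M + sumBelow t i)) →
  ∀ n → Covers (I ∪ Before P n) (N + sumBelow u n) (M + sumBelow t n)
Covers-chain {I} {P} {N} {M} u t P⊥P I⊥P cov Pu Pu+t small zero =
  subst₂ (Covers (I ∪ Before P 0)) (sym (ℕ.+-identityʳ N)) (sym (ℕ.+-identityʳ M)) (Covers-mono inj₁ cov)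
Covers-chain {I} {P} {N} {M} u t P⊥P I⊥P cov Pu Pu+t small (suc n) =
  subst₂ (Covers (I ∪ Before P (suc n))) (ℕ.+-assoc N (sumBelow u n) (u n)) (ℕ.+-assoc M (sumBelow t n) (t n))
    (Covers-mono grow (Covers-extend disjoint (Covers-chain u t P⊥P I⊥P cov Pu Pu+t small n)
      (Pu n) (Pu+t n) (small n)))
  where
  disjoint : (I ∪ Before P n) ⊥ P n
  disjoint (inj₁ Ip , Pnp)              = I⊥P n (Ip , Pnp)
  disjoint (inj₂ (j , j<n , Pjp) , Pnp) = P⊥P j<n (Pnp , Pjp)
  grow : (I ∪ Before P n) ∪ P n ⊆ I ∪ Before P (suc n)
  grow (inj₁ (inj₁ Ip))              = inj₁ Ip
  grow (inj₁ (inj₂ (j , j<n , Pjp))) = inj₂ (j , ℕ.m<n⇒m<1+n j<n , Pjp)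
  grow (inj₂ Pnp)                    = inj₂ (n , ℕ.n<1+n n , Pnp)

-- Expanding (1 + x)^s - 1 over distinct tower bases

powerSum : ℕ → List ℕ → ℕ
powerSum x es = sum (map (x ^_) es)

powerSum-++ : ∀ x es fs → powerSum x (es ++ fs) ≡ powerSum x es + powerSum x fs
powerSum-++ x es fs = trans (cong sum (List.map-++ (x ^_) es fs)) (sum-++ (map (x ^_) es) (map (x ^_) fs))

powerSum-map-suc : ∀ x es → powerSum x (map suc es) ≡ x * powerSum x es
powerSum-map-suc x []       = sym (ℕ.*-zeroʳ x)
powerSum-map-suc x (e ∷ es) =
  trans (cong (x * x ^ e +_) (powerSum-map-suc x es)) (sym (ℕ.*-distribˡ-+ x (x ^ e) (powerSum x es)))

binomialExponents : ℕ → List ℕ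
binomialExponents zero    = []
binomialExponents (suc s) = map suc (binomialExponents s) ++ 1 ∷ binomialExponents s

powerSum-binomialExponents : ∀ x s → powerSum x (binomialExponents s) + 1 ≡ (1 + x) ^ s
powerSum-binomialExponents x zero    = refl
powerSum-binomialExponents x (suc s) = begin
  powerSum x (map suc E ++ 1 ∷ E) + 1       ≡⟨ cong (_+ 1) (powerSum-++ x (map suc E) (1 ∷ E)) ⟩
  powerSum x (map suc E) + (x ^ 1 + P) + 1   ≡⟨ cong (λ y → y + (x ^ 1 + P) + 1) (powerSum-map-suc x E) ⟩
  x * P + (x * 1 + P) + 1                    ≡⟨ factor x P ⟩
  (1 + x) * (P + 1)                          ≡⟨ cong ((1 + x) *_) (powerSum-binomialExponents x s) ⟩
  (1 + x) ^ suc s                            ∎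
  where
  open ≡-Reasoning
  E = binomialExponents s
  P = powerSum x E
  factor : ∀ x P → x * P + (x * 1 + P) + 1 ≡ (1 + x) * (P + 1)
  factor = solve-∀

binomialExponents-positive : ∀ s → All (1 ≤_) (binomialExponents s)
binomialExponents-positive zero    = []
binomialExponents-positive (suc s) =
  All.++⁺ (All.map⁺ (All.universal (λ _ → s≤s z≤n) (binomialExponents s))) (s≤s z≤n ∷ binomialExponents-positive s)

-- (tower c)^(2^(d - c) e) = (tower d)^e, so every monomial (tower d)^e gets a base of its own.
towerTerms : ℕ → ℕ → List ℕ → List (ℕ × ℕ)
towerTerms d c []       = []
towerTerms d c (e ∷ es) = (tower c , 2 ^ (d ∸ c) * e) ∷ towerTerms d (suc c) es

tower^≡tower^ : ∀ {c d} e → c ≤ d → tower c ^ (2 ^ (d ∸ c) * e) ≡ tower d ^ e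
tower^≡tower^ {c} {d} e c≤d = begin
  (2 ^ 2 ^ c) ^ (2 ^ (d ∸ c) * e)   ≡⟨ ℕ.^-*-assoc 2 (2 ^ c) (2 ^ (d ∸ c) * e) ⟩
  2 ^ (2 ^ c * (2 ^ (d ∸ c) * e))   ≡⟨ cong (2 ^_) (ℕ.*-assoc (2 ^ c) (2 ^ (d ∸ c)) e) ⟨
  2 ^ (2 ^ c * 2 ^ (d ∸ c) * e)     ≡⟨ cong (λ x → 2 ^ (x * e)) (ℕ.^-distribˡ-+-* 2 c (d ∸ c)) ⟨
  2 ^ (2 ^ (c + (d ∸ c)) * e)       ≡⟨ cong (λ x → 2 ^ (2 ^ x * e)) (ℕ.m+[n∸m]≡n c≤d) ⟩
  2 ^ (2 ^ d * e)                   ≡⟨ ℕ.^-*-assoc 2 (2 ^ d) e ⟨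
  (2 ^ 2 ^ d) ^ e                   ∎
  where open ≡-Reasoning

towerTerms-sum : ∀ d c es → c + length es ≤ d → sum (map powValue (towerTerms d c es)) ≡ powerSum (tower d) es
towerTerms-sum d c []       _  = refl
towerTerms-sum d c (e ∷ es) le = cong₂ _+_
  (tower^≡tower^ e (ℕ.≤-trans (ℕ.m≤m+n c (suc (length es))) le))
  (towerTerms-sum d (suc c) es (subst (_≤ d) (ℕ.+-suc c (length es)) le))

TowerRange : ℕ → ℕ → Pred (ℕ × ℕ) 0ℓ
TowerRange lo hi (a , k) = ∃[ c ] (lo ≤ c × c < hi × a ≡ tower c)

TowerRange-disjoint : ∀ {lo hi lo′ hi′} → hi ≤ lo′ → TowerRange lo hi ⊥ TowerRange lo′ hi′
TowerRange-disjoint hi≤lo′ ((c , _ , c<hi , refl) , (c′ , lo′≤c′ , _ , a≡tower-c′)) =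
  ℕ.<-irrefl a≡tower-c′ (tower-mono-< (ℕ.<-≤-trans c<hi (ℕ.≤-trans hi≤lo′ lo′≤c′)))

towerTerms-range : ∀ d c es → All (TowerRange c (c + length es)) (towerTerms d c es)
towerTerms-range d c []       = []
towerTerms-range d c (e ∷ es) =
  (c , ℕ.≤-refl , ℕ.m<m+n c (s≤s z≤n) , refl) ∷
  All.map (λ { (c′ , c<c′ , c′<hi , a≡) → c′ , ℕ.<⇒≤ c<c′ , subst (c′ <_) (sym (ℕ.+-suc c (length es))) c′<hi , a≡ })
          (towerTerms-range d (suc c) es)

towerTerms-exponents : ∀ d c es → All (1 ≤_) es →
  All (λ p → 2 ^ (d ∸ (c + length es)) ≤ proj₂ p) (towerTerms d c es)
towerTerms-exponents d c []       _            = []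
towerTerms-exponents d c (e ∷ es) (1≤e ∷ 1≤es) =
  ℕ.≤-trans (ℕ.^-monoʳ-≤ 2 (ℕ.∸-monoʳ-≤ d (ℕ.m≤m+n c (suc (length es))))) (ℕ.m≤m*n _ e {{ℕ.>-nonZero 1≤e}}) ∷
  subst (λ x → All (λ p → 2 ^ (d ∸ x) ≤ proj₂ p) (towerTerms d (suc c) es)) (sym (ℕ.+-suc c (length es)))
        (towerTerms-exponents d (suc c) es 1≤es)

towerTerms-unique : ∀ d c es → Unique (towerTerms d c es)
towerTerms-unique d c []       = []
towerTerms-unique d c (e ∷ es) =
  All.map (λ { (c′ , c<c′ , _ , refl) eq → ℕ.<-irrefl (cong proj₁ eq) (tower-mono-< c<c′) })
          (towerTerms-range d (suc c) es) ∷
  towerTerms-unique d (suc c) es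

-- The set A

module Construction (Q : ℕ) where

  towers towersPlus1 squares A : Set⁺
  towers      = image (λ i → tower (Q + i))
  towersPlus1 = image (λ i → suc (tower (Q + i)))
  squares     = image (λ i → sq (2 + (Q + i)))
  A           = towers ∪ᵇ towersPlus1 ∪ᵇ squares

  A-AllGe2 : AllGe2 A
  A-AllGe2 = AllGe2-∪ᵇ towers (towersPlus1 ∪ᵇ squares)
    (AllGe2-image _ (λ i → 2≤tower (Q + i)))
    (AllGe2-∪ᵇ towersPlus1 squares (AllGe2-image _ (λ i → ℕ.m≤n⇒m≤1+n (2≤tower (Q + i))))
                                   (AllGe2-image _ (λ i → 2≤sq[2+n] (Q + i))))

  partialRecipSum-A : 2 ≤ Q → ∀ N → partialRecipSum A N ≤ℚ 6 /1+ Q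
  partialRecipSum-A 2≤Q N = begin
    partialRecipSum A N
      ≤⟨ partialRecipSum-∪ᵇ towers (towersPlus1 ∪ᵇ squares) N ⟩
    partialRecipSum towers N ℚ.+ partialRecipSum (towersPlus1 ∪ᵇ squares) N
      ≤⟨ ℚ.+-monoʳ-≤ (partialRecipSum towers N) (partialRecipSum-∪ᵇ towersPlus1 squares N) ⟩
    partialRecipSum towers N ℚ.+ (partialRecipSum towersPlus1 N ℚ.+ partialRecipSum squares N)
      ≤⟨ ℚ.+-mono-≤ (partialRecipSum-sparse Q (tower-mono-< ∘ shift) sq≤tower (image-sound _) N)
          (ℚ.+-mono-≤ (partialRecipSum-sparse Q (s≤s ∘ tower-mono-< ∘ shift) (ℕ.m≤n⇒m≤1+n ∘ sq≤tower) (image-sound _) N)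
                      (partialRecipSum-sparse Q (sq-mono-< ∘ s≤s ∘ s≤s ∘ shift) (λ _ → ℕ.≤-refl) (image-sound _) N)) ⟩
    2 /1+ Q ℚ.+ (2 /1+ Q ℚ.+ 2 /1+ Q)
      ≤⟨ ℚ.+-monoʳ-≤ (2 /1+ Q) (/1+-+-≤ 2 2 Q) ⟩
    2 /1+ Q ℚ.+ 4 /1+ Q
      ≤⟨ /1+-+-≤ 2 4 Q ⟩
    6 /1+ Q ∎
    where
    open ℚ.≤-Reasoning
    shift : Monotonic₁ _<_ _<_ (Q +_)
    shift = ℕ.+-monoʳ-< Q
    sq≤tower : ∀ i → sq (2 + (Q + i)) ≤ tower (Q + i)
    sq≤tower i = sq[2+n]≤tower (ℕ.≤-trans 2≤Q (ℕ.m≤m+n Q i))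

  tower∈A : ∀ {c} → Q ≤ c → A (tower c) ≡ true
  tower∈A Q≤c = ∪ᵇ-introˡ towers (towersPlus1 ∪ᵇ squares) (image-shift-complete tower Q≤c (n≤tower _))

  1+tower∈A : ∀ {c} → Q ≤ c → A (suc (tower c)) ≡ true
  1+tower∈A {c} Q≤c = ∪ᵇ-introʳ towers (towersPlus1 ∪ᵇ squares) (∪ᵇ-introˡ towersPlus1 squares {suc (tower c)}
    (image-shift-complete (suc ∘ tower) Q≤c (ℕ.m≤n⇒m≤1+n (n≤tower _))))

  sq∈A : ∀ {z} → Q ≤ z → A (sq (2 + z)) ≡ true
  sq∈A {z} Q≤z = ∪ᵇ-introʳ towers (towersPlus1 ∪ᵇ squares) (∪ᵇ-introʳ towersPlus1 squares {sq (2 + z)}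
    (image-shift-complete (sq ∘ (2 +_)) Q≤z (n≤sq[2+n] _)))

  module Completeness (s : ℕ) where

    L : ℕ
    L = length (binomialExponents s)

    -- Block R expands (1 + tower (blockTop R))^s - 1 over the bases tower c, blockStart R ≤ c <
    -- blockStart R + L; the margin 2 + s in blockTop makes all its exponents exceed s + 1.
    blockStart blockTop gadgetSum : ℕ → ℕ
    blockStart R = Q + R * suc L
    blockTop R   = blockStart R + L + (2 + s)
    gadgetSum R  = powerSum (tower (blockTop R)) (binomialExponents s)

    Gadget Top Block : ℕ → Pred (ℕ × ℕ) 0ℓ
    Gadget R = TowerRange (blockStart R) (blockStart R + L) ∩ (λ p → 2 + s ≤ proj₂ p)
    Top R p  = p ≡ (suc (tower (blockTop R)) , s)
    Block R  = Gadget R ∪ Top R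

    Q≤blockStart : ∀ R → Q ≤ blockStart R
    Q≤blockStart R = ℕ.m≤m+n Q (R * suc L)

    blockStart-suc : ∀ R → blockStart (suc R) ≡ suc (blockStart R + L)
    blockStart-suc R = identity Q R L
      where
      identity : ∀ Q R L → Q + (1 + L + R * (1 + L)) ≡ 1 + (Q + R * (1 + L) + L)
      identity = solve-∀

    blocks-separated : ∀ {R′ R} → R′ < R → blockStart R′ + L < blockStart R
    blocks-separated {R′} {R} R′<R =
      subst (_≤ blockStart R) (blockStart-suc R′) (ℕ.+-monoʳ-≤ Q (ℕ.*-monoˡ-≤ (suc L) R′<R))

    blockTop-mono-< : Monotonic₁ _<_ _<_ blockTop
    blockTop-mono-< R′<R =
      ℕ.+-monoˡ-< (2 + s) (ℕ.+-monoˡ-< L (ℕ.≤-<-trans (ℕ.m≤m+n _ L) (blocks-separated R′<R)))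

    Block-gadget : ∀ R → SumOfDistinct (Block R) (gadgetSum R)
    Block-gadget R = towerTerms (blockTop R) (blockStart R) E ,
      All.map inj₁ (All.zip (towerTerms-range _ _ E ,
                             All.map exponent (towerTerms-exponents _ _ E (binomialExponents-positive s)))) ,
      towerTerms-unique _ _ E ,
      towerTerms-sum _ _ E (ℕ.m≤m+n _ (2 + s))
      where
      E = binomialExponents s
      exponent : ∀ {k} → 2 ^ (blockTop R ∸ (blockStart R + L)) ≤ k → 2 + s ≤ k
      exponent {k} le = ℕ.≤-trans (ℕ.≤-trans (ℕ.m≤n*m (2 + s) 2) (2*n≤2^n (2 + s)))
        (subst (λ x → 2 ^ x ≤ k) (ℕ.m+n∸m≡n (blockStart R + L) (2 + s)) le)

    Block-top : ∀ R → SumOfDistinct (Block R) (gadgetSum R + 1)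
    Block-top R = subst (SumOfDistinct (Block R)) (sym (powerSum-binomialExponents (tower (blockTop R)) s))
                        (SumOfDistinct-singleton (inj₂ refl))

    Block-disjoint : ∀ {R R′} → R′ < R → Block R ⊥ Block R′
    Block-disjoint {R} {R′} R′<R {p} (inj₁ (in-R , _) , inj₁ (in-R′ , _)) =
      TowerRange-disjoint {hi′ = blockStart R + L} (ℕ.<⇒≤ (blocks-separated R′<R)) {p} (in-R′ , in-R)
    Block-disjoint R′<R (inj₁ (_ , 2+s≤k) , inj₂ refl) = ℕ.<-irrefl refl (ℕ.≤-trans (ℕ.n≤1+n (suc s)) 2+s≤k)
    Block-disjoint R′<R (inj₂ refl , inj₁ (_ , 2+s≤k)) = ℕ.<-irrefl refl (ℕ.≤-trans (ℕ.n≤1+n (suc s)) 2+s≤k)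
    Block-disjoint R′<R (inj₂ refl , inj₂ eq)          =
      ℕ.<-irrefl (sym (ℕ.suc-injective (cong proj₁ eq))) (tower-mono-< (blockTop-mono-< R′<R))

    Block⊆IsPowIndex : ∀ R → Block R ⊆ IsPowIndex A s
    Block⊆IsPowIndex R (inj₁ ((c , start≤c , _ , refl) , 2+s≤k)) =
      tower∈A (ℕ.≤-trans (Q≤blockStart R) start≤c) , ℕ.≤-trans (ℕ.m≤n+m s 2) 2+s≤k
    Block⊆IsPowIndex R (inj₂ refl) =
      1+tower∈A (ℕ.≤-trans (Q≤blockStart R) (ℕ.≤-trans (ℕ.m≤m+n _ L) (ℕ.m≤m+n _ (2 + s)))) , ℕ.≤-refl

    -- The offset 4 (s + 1) is what Bernoulli's inequality needs in tailValue-suc≤.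
    tailBase tailValue : ℕ → ℕ
    tailBase j  = Q + 4 * suc s + j
    tailValue j = sq (2 + tailBase j) ^ suc s

    Tail : ℕ → Pred (ℕ × ℕ) 0ℓ
    Tail j p = p ≡ (sq (2 + tailBase j) , suc s)

    Tail-disjoint : ∀ {j j′} → j′ < j → Tail j ⊥ Tail j′
    Tail-disjoint j′<j (refl , eq) =
      ℕ.<-irrefl (sym (cong proj₁ eq)) (sq-mono-< (ℕ.+-monoʳ-< 2 (ℕ.+-monoʳ-< (Q + 4 * suc s) j′<j)))

    Block⊥Tail : ∀ R j → Block R ⊥ Tail j
    Block⊥Tail R j (inj₁ (_ , 2+s≤k) , refl) = ℕ.<-irrefl refl 2+s≤k
    Block⊥Tail R j (inj₂ refl , ())

    Tail⊆IsPowIndex : ∀ j → Tail j ⊆ IsPowIndex A s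
    Tail⊆IsPowIndex j refl = sq∈A (ℕ.≤-trans (ℕ.m≤m+n Q (4 * suc s)) (ℕ.m≤m+n _ j)) , ℕ.n≤1+n s

    tailValue-suc≤ : ∀ j → tailValue (suc j) ≤ 2 * tailValue j
    tailValue-suc≤ j = subst₂ (λ x y → x ≤ 2 * y)
      (trans (sym (sq^≡^ (3 + z) (suc s))) (cong (λ x → sq (2 + x) ^ suc s) (sym (ℕ.+-suc (Q + 4 * suc s) j))))
      (sym (sq^≡^ (2 + z) (suc s)))
      ([1+y]^m≤2*y^m (2 + z) (suc s + suc s) exponent-small)
      where
      z = tailBase j
      quadruple : ∀ s → 2 * (suc s + suc s) ≡ 4 * suc s
      quadruple = solve-∀
      exponent-small : 2 * (suc s + suc s) ≤ 3 + z
      exponent-small = subst (_≤ 3 + z) (sym (quadruple s))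
        (ℕ.≤-trans (ℕ.m≤n+m (4 * suc s) Q) (ℕ.≤-trans (ℕ.m≤m+n _ j) (ℕ.m≤n+m z 3)))

    coveredByBlocks : ∀ R → Covers (∅ ∪ Before Block R) (sumBelow gadgetSum R) (sumBelow (λ _ → 1) R)
    coveredByBlocks = Covers-chain gadgetSum (λ _ → 1) Block-disjoint (λ _ ()) (λ { zero z≤n → SumOfDistinct-[] })
                                   Block-gadget Block-top (λ _ → s≤s z≤n)

    R₀ N₀ M₀ : ℕ
    R₀ = tailValue 0
    N₀ = sumBelow gadgetSum R₀
    M₀ = sumBelow (λ _ → 1) R₀

    tailValue≤ : ∀ j → tailValue j ≤ suc (R₀ + sumBelow tailValue j)
    tailValue≤ zero    = ℕ.≤-trans (ℕ.m≤m+n R₀ 0) (ℕ.n≤1+n _)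
    tailValue≤ (suc j) = begin
      tailValue (suc j)                                ≤⟨ tailValue-suc≤ j ⟩
      2 * tailValue j                                  ≡⟨ double (tailValue j) ⟩
      tailValue j + tailValue j                        ≤⟨ ℕ.+-monoʳ-≤ (tailValue j) (tailValue≤ j) ⟩
      tailValue j + suc (R₀ + sumBelow tailValue j)    ≡⟨ reorder (tailValue j) R₀ (sumBelow tailValue j) ⟩
      suc (R₀ + (sumBelow tailValue j + tailValue j))  ∎
      where
      open ℕ.≤-Reasoning
      double : ∀ x → 2 * x ≡ x + x
      double = solve-∀
      reorder : ∀ x r v → x + suc (r + v) ≡ suc (r + (v + x))
      reorder = solve-∀

    coveredByTails : ∀ j → Covers ((∅ ∪ Before Block R₀) ∪ Before Tail j)
                                  (N₀ + sumBelow (λ _ → 0) j) (M₀ + sumBelow tailValue j)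
    coveredByTails = Covers-chain (λ _ → 0) tailValue Tail-disjoint
      (λ { j (inj₂ (R , _ , in-block) , in-tail) → Block⊥Tail R j (in-block , in-tail) })
      (coveredByBlocks R₀) (λ _ → SumOfDistinct-[]) (λ _ → SumOfDistinct-singleton refl)
      (λ j → ℕ.≤-trans (tailValue≤ j) (s≤s (ℕ.+-monoˡ-≤ _ (n≤sumBelow (λ _ → s≤s z≤n) R₀))))

    covered⊆IsPowIndex : ∀ j → (∅ ∪ Before Block R₀) ∪ Before Tail j ⊆ IsPowIndex A s
    covered⊆IsPowIndex j (inj₁ (inj₂ (R , _ , in-block))) = Block⊆IsPowIndex R in-block
    covered⊆IsPowIndex j (inj₂ (i , _ , in-tail))         = Tail⊆IsPowIndex i in-tail

    complete : PowComplete A s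
    complete = N₀ , covered
      where
      covered : ∀ n → N₀ ≤ n → InSubsetSums A s n
      covered n N₀≤n = SumOfDistinct-mono (covered⊆IsPowIndex r) (subst (SumOfDistinct _) N₀+0+r≡n
        (coveredByTails r r (ℕ.≤-trans (n≤sumBelow (λ j → ℕ.m^n>0 (sq (2 + tailBase j)) (suc s)) r) (ℕ.m≤n+m _ M₀))))
        where
        r = n ∸ N₀
        N₀+0+r≡n : N₀ + sumBelow (λ _ → 0) r + r ≡ n
        N₀+0+r≡n = trans (cong (λ x → N₀ + x + r) (sumBelow-zero r))
                         (trans (cong (_+ r) (ℕ.+-identityʳ N₀)) (ℕ.m+[n∸m]≡n N₀≤n))

-- The construction is complete for every s.
proposition1 : (ε : ℚ) → 0ℚ <ℚ ε →
    ∃[ A ] (AllGe2 A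
      × (∃[ δ ] (δ <ℚ ε × (∀ N → partialRecipSum A N ≤ℚ δ)))
      × (∀ (s : ℕ) → 1 ≤ s → PowComplete A s))
proposition1 ε 0<ε =
  A , A-AllGe2 , (6 /1+ Q , k/1+[k*↧ₙε]<ε 6 ε 0<ε , partialRecipSum-A 2≤Q) , λ s _ → Completeness.complete s
  where
  Q = 6 * ℚ.↧ₙ ε
  open Construction Q
  2≤Q : 2 ≤ Q
  2≤Q = ℕ.≤-trans (s≤s (s≤s z≤n)) (ℕ.m≤m*n 6 (ℚ.↧ₙ ε))
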